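{- Let $k\ge1$ and $q\in\mathbb{Q}$. The $q$-th convolution root $(H_{k,n}(t,q))_{n\ge0}$ of the sequence $(F_{k,n}(t))_{n\ge0}$ is given by $H_{k,0}(t,q)=1$ and, for $n\ge1$, $$H_{k,n}(t,q)=\sum_{\alpha\vdash n}\frac{1}{(\alpha_1+\cdots+\alpha_k)!}\,B^q_{(\sum_i\alpha_i-1)}\binom{\sum_i\alpha_i}{\alpha_1,\ldots,\alpha_k}t^\alpha .$$
   Context: Let $t_1,\ldots,t_k$ be indeterminates, $t^\alpha=t_1^{\alpha_1}\cdots t_k^{\alpha_k}$ for $\alpha\in\mathbb{Z}_{\ge0}^k$, and $\alpha\vdash n$ means $\sum_i i\alpha_i=n$. Let $F_{k,0}=1$ and $F_{k,n}(t)=\sum_{\alpha\vdash n}\binom{\sum_i\alpha_i}{\alpha_1,\ldots,\alpha_k}t^\alpha$ for $n\ge1$ (the generalized Fibonacci polynomials). For $q\in\mathbb{Q}$ and $j\ge0$ put $B^q_{(j)}=q(q+1)\cdots(q+j)$. The level (convolution) product of sequences $(P_n)_{n\ge0},(Q_n)_{n\ge0}$ is $(P*Q)_n=\sum_{i=0}^nP_iQ_{n-i}$. For a sequence $(P_n)_{n\ge0}$ of polynomials with $P_0=1$ and $q\in\mathbb{Q}$, its $q$-th convolution root is the sequence $(H_n)_{n\ge0}$ defined by $\sum_{n\ge0}H_ny^n=\big(\sum_{n\ge0}P_ny^n\big)^q:=\sum_{m\ge0}\binom{q}{m}\big(\sum_{n\ge1}P_ny^n\big)^m$ in formal power series in $y$;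 equivalently, for $q=s/m$ with $m\ge1$, it is the unique sequence with $H_0=1$ whose $m$-fold level product with itself equals the $s$-fold level product of $(P_n)$ (of its level-product inverse if $s<0$). -}

module Defs where

open import Data.Nat as ℕ using (ℕ; zero; suc; _∸_; _!)
open import Data.Nat.Properties using (_!≢0)
open import Data.Integer using (+_)
open import Data.Rational using (ℚ; 0ℚ; 1ℚ; _+_; _*_; _-_; _/_)
open import Data.Vec using (Vec; []; _∷_; zipWith)
open import Data.List using (List; []; _∷_; map; concatMap; upTo; foldr)
open import Data.Bool using (Bool; true; false; if_then_else_; _∧_)
open import Relation.Nullary using (does)

ℕtoℚ : ℕ → ℚ
ℕtoℚ n = + n / 1

inv! : ℕ → ℚ
inv! n = (+ 1 / (n !)) {{n !≢0}}

sumℚ : List ℚ → ℚ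
sumℚ = foldr _+_ 0ℚ

-- Polynomials in t₁,…,t_k with rational coefficients, represented by
-- their coefficient function on exponent vectors α ∈ ℕ^k
-- (P α = coefficient of t^α).  Equality of polynomials = pointwise ≡.

Poly : ℕ → Set
Poly k = Vec ℕ k → ℚ

isZeroVec : ∀ {k} → Vec ℕ k → Bool
isZeroVec [] = true
isZeroVec (zero ∷ α) = isZeroVec α
isZeroVec (suc _ ∷ α) = false

zeroPoly : ∀ {k} → Poly k
zeroPoly _ = 0ℚ

onePoly : ∀ {k} → Poly k
onePoly α = if isZeroVec α then 1ℚ else 0ℚ

below : ∀ {k} → Vec ℕ k → List (Vec ℕ k)
below [] = [] ∷ []
below (a ∷ α) = concatMap (λ b → map (b ∷_) (below α)) (upTo (suc a))

polyMul : ∀ {k} → Poly k → Poly k → Poly k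
polyMul P Q α = sumℚ (map (λ β → P β * Q (zipWith _∸_ α β)) (below α))

-- Sequences of polynomials (= formal power series in y with polynomial
-- coefficients) and the level (convolution) product.

Seq : ℕ → Set
Seq k = ℕ → Poly k

levelProd : ∀ {k} → Seq k → Seq k → Seq k
levelProd A B n α = sumℚ (map (λ i → polyMul (A i) (B (n ∸ i)) α) (upTo (suc n)))

unitSeq : ∀ {k} → Seq k
unitSeq zero = onePoly
unitSeq (suc _) = zeroPoly

positivePart : ∀ {k} → Seq k → Seq k
positivePart P zero = zeroPoly
positivePart P (suc n) = P (suc n)

powPos : ∀ {k} → Seq k → ℕ → Seq k
powPos P zero = unitSeq
powPos P (suc m) = levelProd (positivePart P) (powPos P m)

falling : ℚ → ℕ → ℚ
falling q zero = 1ℚ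
falling q (suc m) = falling q m * (q - ℕtoℚ m)

binomQ : ℚ → ℕ → ℚ
binomQ q m = falling q m * inv! m

-- q-th convolution root:  Σ_n H_n y^n = Σ_m binom(q,m) (Σ_{n≥1} P_n y^n)^m.
-- Since (Σ_{n≥1} P_n y^n)^m has no y^n-term for n < m, the coefficient
-- of y^n only receives contributions from m ≤ n.
convRoot : ∀ {k} → ℚ → Seq k → Seq k
convRoot q P n α = sumℚ (map (λ m → binomQ q m * powPos P m n α) (upTo (suc n)))

weightFrom : ∀ {k} → ℕ → Vec ℕ k → ℕ
weightFrom i [] = 0
weightFrom i (a ∷ α) = i ℕ.* a ℕ.+ weightFrom (suc i) α

weight : ∀ {k} → Vec ℕ k → ℕ
weight = weightFrom 1

size : ∀ {k} → Vec ℕ k → ℕ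
size [] = 0
size (a ∷ α) = a ℕ.+ size α

prodInv! : ∀ {k} → Vec ℕ k → ℚ
prodInv! [] = 1ℚ
prodInv! (a ∷ α) = inv! a * prodInv! α

multinomial : ∀ {k} → Vec ℕ k → ℚ
multinomial α = ℕtoℚ (size α !) * prodInv! α

F : (k : ℕ) → Seq k
F k zero = onePoly
F k (suc n) α = if does (weight α ℕ.≟ suc n) then multinomial α else 0ℚ

B : ℚ → ℕ → ℚ
B q zero = q
B q (suc j) = B q j * (q + ℕtoℚ (suc j))

Hformula : ∀ {k} → ℚ → ℕ → Poly k
Hformula q n α =
  if does (weight α ℕ.≟ n)
  then inv! (size α) * B q (size α ∸ 1) * multinomial α
  else 0ℚ

{-# OPTIONS --safe #-}
module Submission where

-- Put s = t₁y + t₂y² + ⋯ + t_k yᵏ, so that Σₙ F_{k,n} yⁿ = 1/(1 − s) and Σ_{n≥1} F_{k,n} yⁿ = s/(1 − s).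
-- The t^α yⁿ-coefficient of (s/(1 − s))^m is [Σᵢ i αᵢ = n] · (|α|!/α!) · C(|α| − 1, m − 1), the
-- multinomial coefficient times the number of compositions of |α| into m parts.  This follows by
-- induction on m, because polynomials of the form Σ_α A(|α|) t^α/α! multiply by binomial
-- convolution of the coefficient functions A (the multinomial Vandermonde identity).  Summing
-- against C(q, m), the coefficient of t^α in H_{k,n} is the multinomial coefficient times
-- Σ_m C(q, m) C(|α| − 1, m − 1) = C(q + |α| − 1, |α|) = B^q_(|α|−1) / |α|!  (Chu–Vandermonde).

open import Defs
open import Data.Nat using (ℕ; _≤_)
open import Data.Rational using (ℚ)
open import Data.Vec using (Vec)
open import Data.Product using (_×_)
open import Relation.Binary.PropositionalEquality using (_≡_)

open import Data.Bool using (if_then_else_)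
open import Data.Empty using (⊥-elim)
import Data.Integer as ℤ
import Data.Integer.Properties as ℤ
open import Data.List using (List; []; _∷_; map; concatMap; upTo; _++_)
open import Data.List.Properties using (map-∘; map-upTo)
open import Data.Nat as ℕ using (zero; suc; _!; _∸_; _<_; z≤n; s≤s)
import Data.Nat.Coprimality as Coprime
import Data.Nat.Properties as ℕ
import Data.Nat.Tactic.RingSolver as ℕ-Solver
open import Data.Product using (∃-syntax; _,_)
open import Data.Rational using (mkℚ; 0ℚ; 1ℚ; _+_; _*_; _-_; _≟_)
open import Data.Rational.Properties
open import Data.Vec using ([]; _∷_; zipWith)
open import Data.Vec.Relation.Binary.Pointwise.Inductive using (Pointwise; []; _∷_)
open import Relation.Binary.PropositionalEquality
  using (refl; sym; trans; cong; cong₂; subst; subst₂; module ≡-Reasoning)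
open import Relation.Nullary using (does)
open import Relation.Nullary.Decidable using (dec⇒maybe)
open import Tactic.RingSolver using (solve-∀)
import Tactic.RingSolver.Core.AlmostCommutativeRing as ACR

open ≡-Reasoning

private variable
  k : ℕ
  I J : Set

ℚ-ring : ACR.AlmostCommutativeRing _ _
ℚ-ring = ACR.fromCommutativeRing +-*-commutativeRing (λ x → dec⇒maybe (0ℚ ≟ x))

ℕtoℚ≡mkℚ : ∀ n → ℕtoℚ n ≡ mkℚ (ℤ.+ n) 0 (Coprime.sym (Coprime.1-coprimeTo n))
ℕtoℚ≡mkℚ n = normalize-coprime (Coprime.sym (Coprime.1-coprimeTo n))

ℕtoℚ-+ : ∀ m n → ℕtoℚ (m ℕ.+ n) ≡ ℕtoℚ m + ℕtoℚ n
ℕtoℚ-+ m n rewrite ℕtoℚ≡mkℚ m | ℕtoℚ≡mkℚ n =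
  /-cong (sym (cong₂ ℤ._+_ (ℤ.*-identityʳ (ℤ.+ m)) (ℤ.*-identityʳ (ℤ.+ n)))) refl

ℕtoℚ-* : ∀ m n → ℕtoℚ (m ℕ.* n) ≡ ℕtoℚ m * ℕtoℚ n
ℕtoℚ-* m n rewrite ℕtoℚ≡mkℚ m | ℕtoℚ≡mkℚ n = /-cong (ℤ.pos-* m n) refl

!*inv!≡1 : ∀ n → ℕtoℚ (n !) * inv! n ≡ 1ℚ
!*inv!≡1 n with n ! | n ℕ.!≢0
... | suc m | _ rewrite ℕtoℚ≡mkℚ (suc m) | normalize-coprime {1} {m} (Coprime.1-coprimeTo (suc m)) =
  *-inverseʳ (mkℚ (ℤ.+ suc m) 0 (Coprime.sym (Coprime.1-coprimeTo (suc m))))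

inv!-suc : ∀ n → ℕtoℚ (suc n) * inv! (suc n) ≡ inv! n
inv!-suc n = begin
  ℕtoℚ (suc n) * inv! (suc n)
    ≡⟨ sym (*-identityʳ _) ⟩
  ℕtoℚ (suc n) * inv! (suc n) * 1ℚ
    ≡⟨ cong (ℕtoℚ (suc n) * inv! (suc n) *_) (sym (!*inv!≡1 n)) ⟩
  ℕtoℚ (suc n) * inv! (suc n) * (ℕtoℚ (n !) * inv! n)
    ≡⟨ regroup (ℕtoℚ (suc n)) (inv! (suc n)) (ℕtoℚ (n !)) (inv! n) ⟩
  ℕtoℚ (suc n) * ℕtoℚ (n !) * inv! (suc n) * inv! n
    ≡⟨ cong (λ x → x * inv! (suc n) * inv! n) (sym (ℕtoℚ-* (suc n) (n !))) ⟩
  ℕtoℚ (suc n !) * inv! (suc n) * inv! n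
    ≡⟨ cong (_* inv! n) (!*inv!≡1 (suc n)) ⟩
  1ℚ * inv! n
    ≡⟨ *-identityˡ _ ⟩
  inv! n
    ∎
  where
  regroup : ∀ a b c d → a * b * (c * d) ≡ a * c * b * d
  regroup = solve-∀ ℚ-ring

∑ : List I → (I → ℚ) → ℚ
∑ xs f = sumℚ (map f xs)

syntax ∑ xs (λ x → e) = ∑[ x ∈ xs ] e

∑-cong : (xs : List I) {f g : I → ℚ} → (∀ x → f x ≡ g x) → ∑ xs f ≡ ∑ xs g
∑-cong []       eq = refl
∑-cong (x ∷ xs) eq = cong₂ _+_ (eq x) (∑-cong xs eq)

∑-zero : (xs : List I) → ∑[ x ∈ xs ] 0ℚ ≡ 0ℚ
∑-zero []       = refl
∑-zero (x ∷ xs) = trans (+-identityˡ _) (∑-zero xs)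

∑-+ : (xs : List I) (f g : I → ℚ) → ∑[ x ∈ xs ] (f x + g x) ≡ ∑ xs f + ∑ xs g
∑-+ []       f g = refl
∑-+ (x ∷ xs) f g = trans (cong ((f x + g x) +_) (∑-+ xs f g)) (interchange (f x) (g x) (∑ xs f) (∑ xs g))
  where
  interchange : ∀ a b c d → a + b + (c + d) ≡ a + c + (b + d)
  interchange = solve-∀ ℚ-ring

∑-*ˡ : (xs : List I) (c : ℚ) (f : I → ℚ) → ∑[ x ∈ xs ] (c * f x) ≡ c * ∑ xs f
∑-*ˡ []       c f = sym (*-zeroʳ c)
∑-*ˡ (x ∷ xs) c f = trans (cong (c * f x +_) (∑-*ˡ xs c f)) (sym (*-distribˡ-+ c (f x) (∑ xs f)))

∑-++ : (xs ys : List I) (f : I → ℚ) → ∑ (xs ++ ys) f ≡ ∑ xs f + ∑ ys f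
∑-++ []       ys f = sym (+-identityˡ _)
∑-++ (x ∷ xs) ys f = trans (cong (f x +_) (∑-++ xs ys f)) (sym (+-assoc (f x) _ _))

∑-comm : (xs : List I) (ys : List J) (h : I → J → ℚ) →
         ∑[ x ∈ xs ] ∑[ y ∈ ys ] h x y ≡ ∑[ y ∈ ys ] ∑[ x ∈ xs ] h x y
∑-comm []       ys h = sym (∑-zero ys)
∑-comm (x ∷ xs) ys h =
  trans (cong (∑ ys (h x) +_) (∑-comm xs ys h)) (sym (∑-+ ys (h x) (λ y → ∑[ x ∈ xs ] h x y)))

∑-map : (xs : List I) (g : I → J) (f : J → ℚ) → ∑ (map g xs) f ≡ ∑[ x ∈ xs ] f (g x)
∑-map xs g f = cong sumℚ (sym (map-∘ xs))

∑-concatMap : (xs : List I) (g : I → List J) (f : J → ℚ) →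
              ∑ (concatMap g xs) f ≡ ∑[ x ∈ xs ] ∑ (g x) f
∑-concatMap []       g f = refl
∑-concatMap (x ∷ xs) g f =
  trans (∑-++ (g x) (concatMap g xs) f) (cong (∑ (g x) f +_) (∑-concatMap xs g f))

∑-upTo-suc : ∀ n (f : ℕ → ℚ) → ∑ (upTo (suc n)) f ≡ f 0 + ∑[ i ∈ upTo n ] f (suc i)
∑-upTo-suc n f =
  cong (f 0 +_) (trans (cong (λ xs → ∑ xs f) (sym (map-upTo suc n))) (∑-map (upTo n) suc f))

∑-upTo-cong : ∀ n {f g : ℕ → ℚ} → (∀ {i} → i < n → f i ≡ g i) → ∑ (upTo n) f ≡ ∑ (upTo n) g
∑-upTo-cong zero    eq = refl
∑-upTo-cong (suc n) {f} {g} eq = begin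
  ∑ (upTo (suc n)) f               ≡⟨ ∑-upTo-suc n f ⟩
  f 0 + ∑[ i ∈ upTo n ] f (suc i)  ≡⟨ cong₂ _+_ (eq (s≤s z≤n)) (∑-upTo-cong n (λ i<n → eq (s≤s i<n))) ⟩
  g 0 + ∑[ i ∈ upTo n ] g (suc i)  ≡⟨ sym (∑-upTo-suc n g) ⟩
  ∑ (upTo (suc n)) g               ∎

-- Antidiagonal and lattice-path sums

sumAntidiagonal : ℕ → (ℕ → ℕ → ℚ) → ℚ
sumAntidiagonal n Z = ∑[ i ∈ upTo (suc n) ] Z i (n ∸ i)

sumAntidiagonal-cong : ∀ n {Z W : ℕ → ℕ → ℚ} → (∀ i j → i ℕ.+ j ≡ n → Z i j ≡ W i j) →
                       sumAntidiagonal n Z ≡ sumAntidiagonal n W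
sumAntidiagonal-cong n eq =
  ∑-upTo-cong (suc n) (λ {i} i≤n → eq i (n ∸ i) (ℕ.m+[n∸m]≡n (ℕ.≤-pred i≤n)))

sumAntidiagonal-suc : ∀ n (Z : ℕ → ℕ → ℚ) →
  sumAntidiagonal (suc n) Z ≡ Z 0 (suc n) + sumAntidiagonal n (λ i j → Z (suc i) j)
sumAntidiagonal-suc n Z = ∑-upTo-suc (suc n) (λ i → Z i (suc n ∸ i))

sumAntidiagonal-sucʳ : ∀ n (Z : ℕ → ℕ → ℚ) →
  sumAntidiagonal (suc n) Z ≡ sumAntidiagonal n (λ i j → Z i (suc j)) + Z (suc n) 0
sumAntidiagonal-sucʳ zero Z = begin
  Z 0 1 + (Z 1 0 + 0ℚ)  ≡⟨ cong (Z 0 1 +_) (+-identityʳ (Z 1 0)) ⟩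
  Z 0 1 + Z 1 0         ≡⟨ cong (_+ Z 1 0) (sym (+-identityʳ (Z 0 1))) ⟩
  Z 0 1 + 0ℚ + Z 1 0    ∎
sumAntidiagonal-sucʳ (suc n) Z = begin
  sumAntidiagonal (2 ℕ.+ n) Z
    ≡⟨ sumAntidiagonal-suc (suc n) Z ⟩
  Z 0 (2 ℕ.+ n) + sumAntidiagonal (suc n) (λ i j → Z (suc i) j)
    ≡⟨ cong (Z 0 (2 ℕ.+ n) +_) (sumAntidiagonal-sucʳ n (λ i j → Z (suc i) j)) ⟩
  Z 0 (2 ℕ.+ n) + (inner + Z (2 ℕ.+ n) 0)
    ≡⟨ sym (+-assoc (Z 0 (2 ℕ.+ n)) inner (Z (2 ℕ.+ n) 0)) ⟩
  Z 0 (2 ℕ.+ n) + inner + Z (2 ℕ.+ n) 0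
    ≡⟨ cong (_+ Z (2 ℕ.+ n) 0) (sym (sumAntidiagonal-suc n (λ i j → Z i (suc j)))) ⟩
  sumAntidiagonal (suc n) (λ i j → Z i (suc j)) + Z (2 ℕ.+ n) 0
    ∎
  where inner = sumAntidiagonal n (λ i j → Z (suc i) (suc j))

ℕtoℚ*sumAntidiagonal : ∀ n (Z : ℕ → ℕ → ℚ) → ℕtoℚ n * sumAntidiagonal n Z ≡
  sumAntidiagonal n (λ i j → ℕtoℚ i * Z i j) + sumAntidiagonal n (λ i j → ℕtoℚ j * Z i j)
ℕtoℚ*sumAntidiagonal n Z = begin
  ℕtoℚ n * sumAntidiagonal n Z
    ≡⟨ sym (∑-*ˡ (upTo (suc n)) (ℕtoℚ n) _) ⟩
  sumAntidiagonal n (λ i j → ℕtoℚ n * Z i j)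
    ≡⟨ sumAntidiagonal-cong n split ⟩
  sumAntidiagonal n (λ i j → ℕtoℚ i * Z i j + ℕtoℚ j * Z i j)
    ≡⟨ ∑-+ (upTo (suc n)) (λ i → ℕtoℚ i * Z i (n ∸ i)) (λ i → ℕtoℚ (n ∸ i) * Z i (n ∸ i)) ⟩
  sumAntidiagonal n (λ i j → ℕtoℚ i * Z i j) + sumAntidiagonal n (λ i j → ℕtoℚ j * Z i j)
    ∎
  where
  split : ∀ i j → i ℕ.+ j ≡ n → ℕtoℚ n * Z i j ≡ ℕtoℚ i * Z i j + ℕtoℚ j * Z i j
  split i j i+j≡n = begin
    ℕtoℚ n * Z i j                   ≡⟨ cong (λ m → ℕtoℚ m * Z i j) (sym i+j≡n) ⟩
    ℕtoℚ (i ℕ.+ j) * Z i j           ≡⟨ cong (_* Z i j) (ℕtoℚ-+ i j) ⟩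
    (ℕtoℚ i + ℕtoℚ j) * Z i j        ≡⟨ *-distribʳ-+ (Z i j) (ℕtoℚ i) (ℕtoℚ j) ⟩
    ℕtoℚ i * Z i j + ℕtoℚ j * Z i j  ∎

sumAntidiagonal-fst* : ∀ n (Z : ℕ → ℕ → ℚ) →
  sumAntidiagonal (suc n) (λ i j → ℕtoℚ i * Z i j) ≡ sumAntidiagonal n (λ i j → ℕtoℚ (suc i) * Z (suc i) j)
sumAntidiagonal-fst* n Z =
  trans (sumAntidiagonal-suc n (λ i j → ℕtoℚ i * Z i j))
        (trans (cong (_+ sumAntidiagonal n (λ i j → ℕtoℚ (suc i) * Z (suc i) j)) (*-zeroˡ (Z 0 (suc n))))
               (+-identityˡ _))

sumAntidiagonal-snd* : ∀ n (Z : ℕ → ℕ → ℚ) →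
  sumAntidiagonal (suc n) (λ i j → ℕtoℚ j * Z i j) ≡ sumAntidiagonal n (λ i j → ℕtoℚ (suc j) * Z i (suc j))
sumAntidiagonal-snd* n Z =
  trans (sumAntidiagonal-sucʳ n (λ i j → ℕtoℚ j * Z i j))
        (trans (cong (sumAntidiagonal n (λ i j → ℕtoℚ (suc j) * Z i (suc j)) +_) (*-zeroˡ (Z (suc n) 0)))
               (+-identityʳ _))

-- The sum of Y over the endpoints of all 2ⁿ lattice paths of n unit steps, that is,
-- Σᵢ C(n, i) Y i (n − i) without binomial coefficients.
pathSum : ℕ → (ℕ → ℕ → ℚ) → ℚ
pathSum zero    Y = Y 0 0
pathSum (suc n) Y = pathSum n (λ i j → Y i (suc j)) + pathSum n (λ i j → Y (suc i) j)

pathSum-+ : ∀ m n (Y : ℕ → ℕ → ℚ) →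
            pathSum (m ℕ.+ n) Y ≡ pathSum m (λ i j → pathSum n (λ i′ j′ → Y (i ℕ.+ i′) (j ℕ.+ j′)))
pathSum-+ zero    n Y = refl
pathSum-+ (suc m) n Y = cong₂ _+_ (pathSum-+ m n _) (pathSum-+ m n _)

pathSum≡!*sumAntidiagonal : ∀ n (Y : ℕ → ℕ → ℚ) →
  pathSum n Y ≡ ℕtoℚ (n !) * sumAntidiagonal n (λ i j → inv! i * inv! j * Y i j)
pathSum≡!*sumAntidiagonal zero    Y = unit (Y 0 0)
  where
  unit : ∀ y → y ≡ 1ℚ * (1ℚ * 1ℚ * y + 0ℚ)
  unit = solve-∀ ℚ-ring
pathSum≡!*sumAntidiagonal (suc n) Y = sym (begin
  ℕtoℚ (suc n !) * S (suc n) Y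
    ≡⟨ cong (_* S (suc n) Y) (ℕtoℚ-* (suc n) (n !)) ⟩
  ℕtoℚ (suc n) * ℕtoℚ (n !) * S (suc n) Y
    ≡⟨ *-swap (ℕtoℚ (suc n)) (ℕtoℚ (n !)) (S (suc n) Y) ⟩
  ℕtoℚ (n !) * (ℕtoℚ (suc n) * S (suc n) Y)
    ≡⟨ cong (ℕtoℚ (n !) *_) (ℕtoℚ*sumAntidiagonal (suc n) W) ⟩
  ℕtoℚ (n !) * (sumAntidiagonal (suc n) (λ i j → ℕtoℚ i * W i j) +
                sumAntidiagonal (suc n) (λ i j → ℕtoℚ j * W i j))
    ≡⟨ cong (ℕtoℚ (n !) *_) (cong₂ _+_ fstPart sndPart) ⟩
  ℕtoℚ (n !) * (S n Y₁ + S n Y₂)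
    ≡⟨ *-distribˡ-+ (ℕtoℚ (n !)) (S n Y₁) (S n Y₂) ⟩
  ℕtoℚ (n !) * S n Y₁ + ℕtoℚ (n !) * S n Y₂
    ≡⟨ cong₂ _+_ (sym (pathSum≡!*sumAntidiagonal n Y₁)) (sym (pathSum≡!*sumAntidiagonal n Y₂)) ⟩
  pathSum n Y₁ + pathSum n Y₂
    ≡⟨ +-comm (pathSum n Y₁) (pathSum n Y₂) ⟩
  pathSum (suc n) Y
    ∎)
  where
  S : ℕ → (ℕ → ℕ → ℚ) → ℚ
  S m Z = sumAntidiagonal m (λ i j → inv! i * inv! j * Z i j)
  W Y₁ Y₂ : ℕ → ℕ → ℚ
  W  i j = inv! i * inv! j * Y i j
  Y₁ i j = Y (suc i) j
  Y₂ i j = Y i (suc j)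
  *-swap : ∀ a b c → a * b * c ≡ b * (a * c)
  *-swap = solve-∀ ℚ-ring
  regroupFst : ∀ a b c y → a * (b * c * y) ≡ a * b * c * y
  regroupFst = solve-∀ ℚ-ring
  regroupSnd : ∀ a b c y → a * (b * c * y) ≡ b * (a * c) * y
  regroupSnd = solve-∀ ℚ-ring
  shiftFst : ∀ i j → ℕtoℚ (suc i) * W (suc i) j ≡ inv! i * inv! j * Y₁ i j
  shiftFst i j = trans (regroupFst (ℕtoℚ (suc i)) (inv! (suc i)) (inv! j) (Y₁ i j))
                       (cong (λ x → x * inv! j * Y₁ i j) (inv!-suc i))
  shiftSnd : ∀ i j → ℕtoℚ (suc j) * W i (suc j) ≡ inv! i * inv! j * Y₂ i j
  shiftSnd i j = trans (regroupSnd (ℕtoℚ (suc j)) (inv! i) (inv! (suc j)) (Y₂ i j))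
                       (cong (λ x → inv! i * x * Y₂ i j) (inv!-suc j))
  fstPart : sumAntidiagonal (suc n) (λ i j → ℕtoℚ i * W i j) ≡ S n Y₁
  fstPart = trans (sumAntidiagonal-fst* n W) (∑-cong (upTo (suc n)) (λ i → shiftFst i (n ∸ i)))
  sndPart : sumAntidiagonal (suc n) (λ i j → ℕtoℚ j * W i j) ≡ S n Y₂
  sndPart = trans (sumAntidiagonal-snd* n W) (∑-cong (upTo (suc n)) (λ i → shiftSnd i (n ∸ i)))

sumAntidiagonal-inv! : ∀ n (Y : ℕ → ℕ → ℚ) →
  sumAntidiagonal n (λ i j → inv! i * inv! j * Y i j) ≡ inv! n * pathSum n Y
sumAntidiagonal-inv! n Y = begin
  S                          ≡⟨ sym (*-identityˡ S) ⟩
  1ℚ * S                     ≡⟨ cong (_* S) (sym (trans (*-comm (inv! n) (ℕtoℚ (n !))) (!*inv!≡1 n))) ⟩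
  inv! n * ℕtoℚ (n !) * S    ≡⟨ *-assoc (inv! n) (ℕtoℚ (n !)) S ⟩
  inv! n * (ℕtoℚ (n !) * S)  ≡⟨ cong (inv! n *_) (sym (pathSum≡!*sumAntidiagonal n Y)) ⟩
  inv! n * pathSum n Y       ∎
  where S = sumAntidiagonal n (λ i j → inv! i * inv! j * Y i j)

-- Exponential polynomials

_∸ᵥ_ : Vec ℕ k → Vec ℕ k → Vec ℕ k
α ∸ᵥ β = zipWith _∸_ α β

∑-below-∷ : ∀ a (α : Vec ℕ k) (f : Vec ℕ (suc k) → ℚ) →
            ∑ (below (a ∷ α)) f ≡ ∑[ b ∈ upTo (suc a) ] ∑[ β ∈ below α ] f (b ∷ β)
∑-below-∷ a α f = trans (∑-concatMap (upTo (suc a)) (λ b → map (b ∷_) (below α)) f)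
                        (∑-cong (upTo (suc a)) (λ b → ∑-map (below α) (b ∷_) f))

∑-below-cong : ∀ (α : Vec ℕ k) {f g : Vec ℕ k → ℚ} → (∀ β → Pointwise _≤_ β α → f β ≡ g β) →
               ∑ (below α) f ≡ ∑ (below α) g
∑-below-cong []      eq = cong (_+ 0ℚ) (eq [] [])
∑-below-cong (a ∷ α) {f} {g} eq = begin
  ∑ (below (a ∷ α)) f
    ≡⟨ ∑-below-∷ a α f ⟩
  ∑[ b ∈ upTo (suc a) ] ∑[ β ∈ below α ] f (b ∷ β)
    ≡⟨ ∑-upTo-cong (suc a) (λ b≤a → ∑-below-cong α (λ β β≤α → eq _ (ℕ.≤-pred b≤a ∷ β≤α))) ⟩
  ∑[ b ∈ upTo (suc a) ] ∑[ β ∈ below α ] g (b ∷ β)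
    ≡⟨ sym (∑-below-∷ a α g) ⟩
  ∑ (below (a ∷ α)) g
    ∎

-- The multinomial Vandermonde identity, divided by α!.
∑-below-prodInv! : ∀ (α : Vec ℕ k) (Ψ : ℕ → ℕ → ℚ) →
  ∑[ β ∈ below α ] (prodInv! β * prodInv! (α ∸ᵥ β) * Ψ (size β) (size (α ∸ᵥ β))) ≡
  prodInv! α * pathSum (size α) Ψ
∑-below-prodInv! []      Ψ = unit (Ψ 0 0)
  where
  unit : ∀ y → 1ℚ * 1ℚ * y + 0ℚ ≡ 1ℚ * y
  unit = solve-∀ ℚ-ring
∑-below-prodInv! (a ∷ α) Ψ = begin
  ∑ (below (a ∷ α)) T
    ≡⟨ ∑-below-∷ a α T ⟩
  ∑[ b ∈ upTo (suc a) ] ∑[ β ∈ below α ] T (b ∷ β)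
    ≡⟨ ∑-cong (upTo (suc a)) inner ⟩
  ∑[ b ∈ upTo (suc a) ] (prodInv! α * (inv! b * inv! (a ∸ b) * Ψ′ b (a ∸ b)))
    ≡⟨ ∑-*ˡ (upTo (suc a)) (prodInv! α) (λ b → inv! b * inv! (a ∸ b) * Ψ′ b (a ∸ b)) ⟩
  prodInv! α * sumAntidiagonal a (λ b c → inv! b * inv! c * Ψ′ b c)
    ≡⟨ cong (prodInv! α *_) (sumAntidiagonal-inv! a Ψ′) ⟩
  prodInv! α * (inv! a * pathSum a Ψ′)
    ≡⟨ cong (λ x → prodInv! α * (inv! a * x)) (sym (pathSum-+ a (size α) Ψ)) ⟩
  prodInv! α * (inv! a * pathSum (a ℕ.+ size α) Ψ)
    ≡⟨ *-leftComm (prodInv! α) (inv! a) (pathSum (a ℕ.+ size α) Ψ) ⟩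
  inv! a * (prodInv! α * pathSum (a ℕ.+ size α) Ψ)
    ≡⟨ sym (*-assoc (inv! a) (prodInv! α) (pathSum (a ℕ.+ size α) Ψ)) ⟩
  inv! a * prodInv! α * pathSum (a ℕ.+ size α) Ψ
    ∎
  where
  T : Vec ℕ (suc _) → ℚ
  T β = prodInv! β * prodInv! ((a ∷ α) ∸ᵥ β) * Ψ (size β) (size ((a ∷ α) ∸ᵥ β))
  Ψ′ : ℕ → ℕ → ℚ
  Ψ′ b c = pathSum (size α) (λ l r → Ψ (b ℕ.+ l) (c ℕ.+ r))
  *-leftComm : ∀ x y z → x * (y * z) ≡ y * (x * z)
  *-leftComm = solve-∀ ℚ-ring
  regroup : ∀ x y z w v → x * y * (z * w) * v ≡ x * z * (y * w * v)
  regroup = solve-∀ ℚ-ring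
  inner : ∀ b → ∑[ β ∈ below α ] T (b ∷ β) ≡ prodInv! α * (inv! b * inv! (a ∸ b) * Ψ′ b (a ∸ b))
  inner b = begin
    ∑[ β ∈ below α ] T (b ∷ β)
      ≡⟨ ∑-cong (below α) (λ β → regroup (inv! b) (prodInv! β) (inv! c) (prodInv! (α ∸ᵥ β))
                                         (Ψᵇᶜ (size β) (size (α ∸ᵥ β)))) ⟩
    ∑[ β ∈ below α ] (inv! b * inv! c * U β)
      ≡⟨ ∑-*ˡ (below α) (inv! b * inv! c) U ⟩
    inv! b * inv! c * ∑ (below α) U
      ≡⟨ cong (inv! b * inv! c *_) (∑-below-prodInv! α Ψᵇᶜ) ⟩
    inv! b * inv! c * (prodInv! α * Ψ′ b c)
      ≡⟨ *-leftComm (inv! b * inv! c) (prodInv! α) (Ψ′ b c) ⟩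
    prodInv! α * (inv! b * inv! c * Ψ′ b c)
      ∎
    where
    c = a ∸ b
    Ψᵇᶜ : ℕ → ℕ → ℚ
    Ψᵇᶜ l r = Ψ (b ℕ.+ l) (c ℕ.+ r)
    U : Vec ℕ _ → ℚ
    U β = prodInv! β * prodInv! (α ∸ᵥ β) * Ψᵇᶜ (size β) (size (α ∸ᵥ β))

expPoly : (ℕ → ℚ) → Poly k
expPoly f β = f (size β) * prodInv! β

binomialConvolution : (ℕ → ℚ) → (ℕ → ℚ) → ℕ → ℚ
binomialConvolution f g n = pathSum n (λ i j → f i * g j)

polyMul-expPoly : ∀ f g (α : Vec ℕ k) → polyMul (expPoly f) (expPoly g) α ≡ expPoly (binomialConvolution f g) α
polyMul-expPoly f g α = begin
  polyMul (expPoly f) (expPoly g) α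
    ≡⟨ ∑-cong (below α) (λ β → regroup (f (size β)) (prodInv! β) (g (size (α ∸ᵥ β))) (prodInv! (α ∸ᵥ β))) ⟩
  ∑[ β ∈ below α ] (prodInv! β * prodInv! (α ∸ᵥ β) * (f (size β) * g (size (α ∸ᵥ β))))
    ≡⟨ ∑-below-prodInv! α (λ i j → f i * g j) ⟩
  prodInv! α * binomialConvolution f g (size α)
    ≡⟨ *-comm (prodInv! α) (binomialConvolution f g (size α)) ⟩
  expPoly (binomialConvolution f g) α
    ∎
  where
  regroup : ∀ x y z w → x * y * (z * w) ≡ y * w * (x * z)
  regroup = solve-∀ ℚ-ring

-- Grading by weight

monomial : ℕ → ℚ → ℕ → ℚ
monomial u x n = if does (u ℕ.≟ n) then x else 0ℚ

monomial-cong : ∀ u n {x y} → (u ≡ n → x ≡ y) → monomial u x n ≡ monomial u y n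
monomial-cong zero    zero    eq = eq refl
monomial-cong zero    (suc n) eq = refl
monomial-cong (suc u) zero    eq = refl
monomial-cong (suc u) (suc n) eq = monomial-cong u n (λ u≡n → eq (cong suc u≡n))

monomial-zero : ∀ u n → monomial u 0ℚ n ≡ 0ℚ
monomial-zero zero    zero    = refl
monomial-zero zero    (suc n) = refl
monomial-zero (suc u) zero    = refl
monomial-zero (suc u) (suc n) = monomial-zero u n

*-monomial : ∀ u x y n → x * monomial u y n ≡ monomial u (x * y) n
*-monomial zero    x y zero    = refl
*-monomial zero    x y (suc n) = *-zeroʳ x
*-monomial (suc u) x y zero    = *-zeroʳ x
*-monomial (suc u) x y (suc n) = *-monomial u x y n

∑-monomial : ∀ (xs : List I) u n (f : I → ℚ) → ∑[ x ∈ xs ] monomial u (f x) n ≡ monomial u (∑ xs f) n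
∑-monomial xs zero    zero    f = refl
∑-monomial xs zero    (suc n) f = ∑-zero xs
∑-monomial xs (suc u) zero    f = ∑-zero xs
∑-monomial xs (suc u) (suc n) f = ∑-monomial xs u n f

sumAntidiagonal-monomial : ∀ u v x y n →
  sumAntidiagonal n (λ i j → monomial u x i * monomial v y j) ≡ monomial (u ℕ.+ v) (x * y) n
sumAntidiagonal-monomial zero    v x y zero    = trans (+-identityʳ _) (*-monomial v x y 0)
sumAntidiagonal-monomial (suc u) v x y zero    = trans (+-identityʳ _) (*-zeroˡ (monomial v y 0))
sumAntidiagonal-monomial zero    v x y (suc n) = begin
  sumAntidiagonal (suc n) (λ i j → monomial 0 x i * monomial v y j)
    ≡⟨ sumAntidiagonal-suc n (λ i j → monomial 0 x i * monomial v y j) ⟩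
  x * monomial v y (suc n) + sumAntidiagonal n (λ i j → 0ℚ * monomial v y j)
    ≡⟨ cong (x * monomial v y (suc n) +_) rest≡0 ⟩
  x * monomial v y (suc n) + 0ℚ
    ≡⟨ +-identityʳ _ ⟩
  x * monomial v y (suc n)
    ≡⟨ *-monomial v x y (suc n) ⟩
  monomial v (x * y) (suc n)
    ∎
  where
  rest≡0 : sumAntidiagonal n (λ i j → 0ℚ * monomial v y j) ≡ 0ℚ
  rest≡0 = trans (∑-cong (upTo (suc n)) (λ i → *-zeroˡ (monomial v y (n ∸ i)))) (∑-zero (upTo (suc n)))
sumAntidiagonal-monomial (suc u) v x y (suc n) = begin
  sumAntidiagonal (suc n) (λ i j → monomial (suc u) x i * monomial v y j)
    ≡⟨ sumAntidiagonal-suc n (λ i j → monomial (suc u) x i * monomial v y j) ⟩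
  0ℚ * monomial v y (suc n) + rest
    ≡⟨ cong (_+ rest) (*-zeroˡ (monomial v y (suc n))) ⟩
  0ℚ + rest
    ≡⟨ +-identityˡ rest ⟩
  rest
    ≡⟨ sumAntidiagonal-monomial u v x y n ⟩
  monomial (u ℕ.+ v) (x * y) n
    ∎
  where rest = sumAntidiagonal n (λ i j → monomial u x i * monomial v y j)

-- The series obtained from a polynomial by substituting tᵢ ↦ tᵢ yⁱ.
byWeight : Poly k → Seq k
byWeight a n α = monomial (weight α) (a α) n

weightFrom-∸ᵥ : ∀ i {α β : Vec ℕ k} → Pointwise _≤_ β α →
                weightFrom i α ≡ weightFrom i β ℕ.+ weightFrom i (α ∸ᵥ β)
weightFrom-∸ᵥ i {[]}    {[]}    []            = refl
weightFrom-∸ᵥ i {a ∷ α} {b ∷ β} (b≤a ∷ β≤α) = begin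
  i ℕ.* a ℕ.+ weightFrom (suc i) α
    ≡⟨ cong₂ (λ a′ w → i ℕ.* a′ ℕ.+ w) (sym (ℕ.m+[n∸m]≡n b≤a)) (weightFrom-∸ᵥ (suc i) β≤α) ⟩
  i ℕ.* (b ℕ.+ (a ∸ b)) ℕ.+ (weightFrom (suc i) β ℕ.+ weightFrom (suc i) (α ∸ᵥ β))
    ≡⟨ interchange i b (a ∸ b) (weightFrom (suc i) β) (weightFrom (suc i) (α ∸ᵥ β)) ⟩
  i ℕ.* b ℕ.+ weightFrom (suc i) β ℕ.+ (i ℕ.* (a ∸ b) ℕ.+ weightFrom (suc i) (α ∸ᵥ β))
    ∎
  where
  interchange : ∀ i b c u v → i ℕ.* (b ℕ.+ c) ℕ.+ (u ℕ.+ v) ≡ i ℕ.* b ℕ.+ u ℕ.+ (i ℕ.* c ℕ.+ v)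
  interchange = solve-∀ ℕ-Solver.ring

levelProd-byWeight : ∀ (a b : Poly k) n α → levelProd (byWeight a) (byWeight b) n α ≡ byWeight (polyMul a b) n α
levelProd-byWeight a b n α = begin
  levelProd (byWeight a) (byWeight b) n α
    ≡⟨ ∑-comm (upTo (suc n)) (below α) (λ i β → byWeight a i β * byWeight b (n ∸ i) (α ∸ᵥ β)) ⟩
  ∑[ β ∈ below α ] sumAntidiagonal n (λ i j → byWeight a i β * byWeight b j (α ∸ᵥ β))
    ≡⟨ ∑-below-cong α product ⟩
  ∑[ β ∈ below α ] monomial (weight α) (a β * b (α ∸ᵥ β)) n
    ≡⟨ ∑-monomial (below α) (weight α) n (λ β → a β * b (α ∸ᵥ β)) ⟩
  byWeight (polyMul a b) n α
    ∎
  where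
  product : ∀ β → Pointwise _≤_ β α →
    sumAntidiagonal n (λ i j → byWeight a i β * byWeight b j (α ∸ᵥ β)) ≡ monomial (weight α) (a β * b (α ∸ᵥ β)) n
  product β β≤α = trans (sumAntidiagonal-monomial (weight β) (weight (α ∸ᵥ β)) (a β) (b (α ∸ᵥ β)) n)
                        (cong (λ w → monomial w (a β * b (α ∸ᵥ β)) n) (sym (weightFrom-∸ᵥ 1 β≤α)))

levelProd-cong : {P P′ Q Q′ : Seq k} → (∀ n α → P n α ≡ P′ n α) → (∀ n α → Q n α ≡ Q′ n α) →
                 ∀ n α → levelProd P Q n α ≡ levelProd P′ Q′ n α
levelProd-cong P≡P′ Q≡Q′ n α =
  ∑-cong (upTo (suc n)) (λ i → ∑-cong (below α) (λ β → cong₂ _*_ (P≡P′ i β) (Q≡Q′ (n ∸ i) (α ∸ᵥ β))))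

size≤weightFrom : ∀ i (β : Vec ℕ k) → size β ≤ weightFrom (suc i) β
size≤weightFrom i []      = z≤n
size≤weightFrom i (b ∷ β) = ℕ.+-mono-≤ (ℕ.m≤n*m b (suc i)) (size≤weightFrom (suc i) β)

weight≡0⇒size≡0 : ∀ (β : Vec ℕ k) → weight β ≡ 0 → size β ≡ 0
weight≡0⇒size≡0 β w = ℕ.n≤0⇒n≡0 (subst (size β ≤_) w (size≤weightFrom 0 β))

size≡0⇒weightFrom≡0 : ∀ i (β : Vec ℕ k) → size β ≡ 0 → weightFrom i β ≡ 0
size≡0⇒weightFrom≡0 i []         _ = refl
size≡0⇒weightFrom≡0 i (zero ∷ β) s = cong₂ ℕ._+_ (ℕ.*-zeroʳ i) (size≡0⇒weightFrom≡0 (suc i) β s)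

weight≡suc⇒size≡suc : ∀ (β : Vec ℕ k) {n} → weight β ≡ suc n → ∃[ s ] size β ≡ suc s
weight≡suc⇒size≡suc β w with size β in eq
... | zero  = ⊥-elim (ℕ.0≢1+n (trans (sym (size≡0⇒weightFrom≡0 1 β eq)) w))
... | suc s = s , refl

size≡0⇒prodInv!≡1 : ∀ (β : Vec ℕ k) → size β ≡ 0 → prodInv! β ≡ 1ℚ
size≡0⇒prodInv!≡1 []         _ = refl
size≡0⇒prodInv!≡1 (zero ∷ β) s = trans (*-identityˡ (prodInv! β)) (size≡0⇒prodInv!≡1 β s)

isZeroVec≡weightFrom≟0 : ∀ i (β : Vec ℕ k) → isZeroVec β ≡ does (weightFrom (suc i) β ℕ.≟ 0)
isZeroVec≡weightFrom≟0 i []          = refl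
isZeroVec≡weightFrom≟0 i (zero ∷ β)  rewrite ℕ.*-zeroʳ i = isZeroVec≡weightFrom≟0 (suc i) β
isZeroVec≡weightFrom≟0 i (suc b ∷ β) = refl

-- Powers of Σ_{n≥1} F_{k,n} yⁿ

-- The number of compositions of s into j positive parts, C(s − 1, j − 1), by the
-- recursion on whether the last part is 1.
compositions : ℕ → ℕ → ℚ
compositions zero    zero    = 1ℚ
compositions zero    (suc s) = 0ℚ
compositions (suc j) zero    = 0ℚ
compositions (suc j) (suc s) = compositions (suc j) s + compositions j s

compositions-1 : ∀ s → compositions 1 (suc s) ≡ 1ℚ
compositions-1 zero    = refl
compositions-1 (suc s) = cong (_+ 0ℚ) (compositions-1 s)

sumAntidiagonal-compositions : ∀ j s →
  sumAntidiagonal s (λ _ r → compositions j r) ≡ compositions (suc j) (suc s)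
sumAntidiagonal-compositions j zero    =
  trans (+-identityʳ (compositions j 0)) (sym (+-identityˡ (compositions j 0)))
sumAntidiagonal-compositions j (suc s) = begin
  sumAntidiagonal (suc s) (λ _ r → compositions j r)
    ≡⟨ sumAntidiagonal-suc s (λ _ r → compositions j r) ⟩
  compositions j (suc s) + sumAntidiagonal s (λ _ r → compositions j r)
    ≡⟨ cong (compositions j (suc s) +_) (sumAntidiagonal-compositions j s) ⟩
  compositions j (suc s) + compositions (suc j) (suc s)
    ≡⟨ +-comm (compositions j (suc s)) (compositions (suc j) (suc s)) ⟩
  compositions (suc j) (suc (suc s))
    ∎

compositions-suc : ∀ j s →
  sumAntidiagonal s (λ l r → compositions 1 l * compositions j r) ≡ compositions (suc j) s
compositions-suc j zero    = trans (+-identityʳ _) (*-zeroˡ (compositions j 0))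
compositions-suc j (suc s) = begin
  sumAntidiagonal (suc s) (λ l r → compositions 1 l * compositions j r)
    ≡⟨ sumAntidiagonal-suc s (λ l r → compositions 1 l * compositions j r) ⟩
  0ℚ * compositions j (suc s) + sumAntidiagonal s (λ l r → compositions 1 (suc l) * compositions j r)
    ≡⟨ cong₂ _+_ (*-zeroˡ (compositions j (suc s))) (∑-cong (upTo (suc s)) (λ l → firstPart l (s ∸ l))) ⟩
  0ℚ + sumAntidiagonal s (λ _ r → compositions j r)
    ≡⟨ +-identityˡ _ ⟩
  sumAntidiagonal s (λ _ r → compositions j r)
    ≡⟨ sumAntidiagonal-compositions j s ⟩
  compositions (suc j) (suc s)
    ∎
  where
  firstPart : ∀ l r → compositions 1 (suc l) * compositions j r ≡ compositions j r
  firstPart l r = trans (cong (_* compositions j r) (compositions-1 l)) (*-identityˡ (compositions j r))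

powPosCoeff : ℕ → ℕ → ℚ
powPosCoeff m s = ℕtoℚ (s !) * compositions m s

binomialConvolution-powPosCoeff : ∀ j s →
  binomialConvolution (powPosCoeff 1) (powPosCoeff j) s ≡ powPosCoeff (suc j) s
binomialConvolution-powPosCoeff j s = begin
  pathSum s (λ l r → powPosCoeff 1 l * powPosCoeff j r)
    ≡⟨ pathSum≡!*sumAntidiagonal s (λ l r → powPosCoeff 1 l * powPosCoeff j r) ⟩
  ℕtoℚ (s !) * sumAntidiagonal s (λ l r → inv! l * inv! r * (powPosCoeff 1 l * powPosCoeff j r))
    ≡⟨ cong (ℕtoℚ (s !) *_) (∑-cong (upTo (suc s)) (λ l → cancel l (s ∸ l))) ⟩
  ℕtoℚ (s !) * sumAntidiagonal s (λ l r → compositions 1 l * compositions j r)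
    ≡⟨ cong (ℕtoℚ (s !) *_) (compositions-suc j s) ⟩
  powPosCoeff (suc j) s
    ∎
  where
  regroup : ∀ a b c d x y → a * b * (c * x * (d * y)) ≡ c * a * (d * b) * (x * y)
  regroup = solve-∀ ℚ-ring
  cancel : ∀ l r → inv! l * inv! r * (powPosCoeff 1 l * powPosCoeff j r) ≡ compositions 1 l * compositions j r
  cancel l r = begin
    inv! l * inv! r * (ℕtoℚ (l !) * compositions 1 l * (ℕtoℚ (r !) * compositions j r))
      ≡⟨ regroup (inv! l) (inv! r) (ℕtoℚ (l !)) (ℕtoℚ (r !)) (compositions 1 l) (compositions j r) ⟩
    ℕtoℚ (l !) * inv! l * (ℕtoℚ (r !) * inv! r) * (compositions 1 l * compositions j r)
      ≡⟨ cong₂ (λ x y → x * y * (compositions 1 l * compositions j r)) (!*inv!≡1 l) (!*inv!≡1 r) ⟩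
    1ℚ * 1ℚ * (compositions 1 l * compositions j r)
      ≡⟨ *-identityˡ _ ⟩
    compositions 1 l * compositions j r
      ∎

unitSeq≡byWeight : ∀ n (β : Vec ℕ k) → unitSeq n β ≡ byWeight (expPoly (powPosCoeff 0)) n β
unitSeq≡byWeight zero    β =
  trans (cong (λ b → if b then 1ℚ else 0ℚ) (isZeroVec≡weightFrom≟0 0 β)) (monomial-cong (weight β) 0 unit)
  where
  unit : weight β ≡ 0 → 1ℚ ≡ powPosCoeff 0 (size β) * prodInv! β
  unit w = sym (begin
    powPosCoeff 0 (size β) * prodInv! β  ≡⟨ cong (λ s → powPosCoeff 0 s * prodInv! β) size≡0 ⟩
    1ℚ * prodInv! β                      ≡⟨ *-identityˡ (prodInv! β) ⟩
    prodInv! β                           ≡⟨ size≡0⇒prodInv!≡1 β size≡0 ⟩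
    1ℚ                                   ∎)
    where size≡0 = weight≡0⇒size≡0 β w
unitSeq≡byWeight (suc n) β =
  trans (sym (monomial-zero (weight β) (suc n))) (monomial-cong (weight β) (suc n) vanish)
  where
  vanish : weight β ≡ suc n → 0ℚ ≡ powPosCoeff 0 (size β) * prodInv! β
  vanish w with weight≡suc⇒size≡suc β w
  ... | s , size≡1+s = sym (begin
    powPosCoeff 0 (size β) * prodInv! β  ≡⟨ cong (λ t → powPosCoeff 0 t * prodInv! β) size≡1+s ⟩
    ℕtoℚ (suc s !) * 0ℚ * prodInv! β     ≡⟨ cong (_* prodInv! β) (*-zeroʳ (ℕtoℚ (suc s !))) ⟩
    0ℚ * prodInv! β                      ≡⟨ *-zeroˡ (prodInv! β) ⟩
    0ℚ                                   ∎)

positivePart-F≡byWeight : ∀ k n (β : Vec ℕ k) →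
  positivePart (F k) n β ≡ byWeight (expPoly (powPosCoeff 1)) n β
positivePart-F≡byWeight k zero    β =
  trans (sym (monomial-zero (weight β) 0)) (monomial-cong (weight β) 0 vanish)
  where
  vanish : weight β ≡ 0 → 0ℚ ≡ powPosCoeff 1 (size β) * prodInv! β
  vanish w = sym (trans (cong (λ s → powPosCoeff 1 s * prodInv! β) (weight≡0⇒size≡0 β w))
                        (*-zeroˡ (prodInv! β)))
positivePart-F≡byWeight k (suc n) β = monomial-cong (weight β) (suc n) multinomial≡
  where
  multinomial≡ : weight β ≡ suc n → multinomial β ≡ powPosCoeff 1 (size β) * prodInv! β
  multinomial≡ w with weight≡suc⇒size≡suc β w
  ... | s , size≡1+s = cong (_* prodInv! β) (sym (begin
    ℕtoℚ (size β !) * compositions 1 (size β)  ≡⟨ cong (λ t → ℕtoℚ (size β !) * compositions 1 t) size≡1+s ⟩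
    ℕtoℚ (size β !) * compositions 1 (suc s)   ≡⟨ cong (ℕtoℚ (size β !) *_) (compositions-1 s) ⟩
    ℕtoℚ (size β !) * 1ℚ                       ≡⟨ *-identityʳ (ℕtoℚ (size β !)) ⟩
    ℕtoℚ (size β !)                            ∎))

powPos-F≡byWeight : ∀ k m n (β : Vec ℕ k) → powPos (F k) m n β ≡ byWeight (expPoly (powPosCoeff m)) n β
powPos-F≡byWeight k zero    n β = unitSeq≡byWeight n β
powPos-F≡byWeight k (suc m) n β = begin
  levelProd (positivePart (F k)) (powPos (F k) m) n β
    ≡⟨ levelProd-cong (positivePart-F≡byWeight k) (powPos-F≡byWeight k m) n β ⟩
  levelProd (byWeight (expPoly (powPosCoeff 1))) (byWeight (expPoly (powPosCoeff m))) n β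
    ≡⟨ levelProd-byWeight (expPoly (powPosCoeff 1)) (expPoly (powPosCoeff m)) n β ⟩
  byWeight (polyMul (expPoly (powPosCoeff 1)) (expPoly (powPosCoeff m))) n β
    ≡⟨ cong (λ x → monomial (weight β) x n) (polyMul-expPoly (powPosCoeff 1) (powPosCoeff m) β) ⟩
  byWeight (expPoly (binomialConvolution (powPosCoeff 1) (powPosCoeff m))) n β
    ≡⟨ cong (λ x → monomial (weight β) (x * prodInv! β) n) (binomialConvolution-powPosCoeff m (size β)) ⟩
  byWeight (expPoly (powPosCoeff (suc m))) n β
    ∎

-- Generalized binomial coefficients

+ℕtoℚ-suc : ∀ q s → q + ℕtoℚ (suc s) ≡ q + ℕtoℚ s + 1ℚ
+ℕtoℚ-suc q s = trans (cong (q +_) (ℕtoℚ-+ 1 s)) (shift q (ℕtoℚ s))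
  where
  shift : ∀ q c → q + (1ℚ + c) ≡ q + c + 1ℚ
  shift = solve-∀ ℚ-ring

falling-+1 : ∀ x m → falling (x + 1ℚ) (suc m) ≡ (x + 1ℚ) * falling x m
falling-+1 x zero    = base x
  where
  base : ∀ x → 1ℚ * (x + 1ℚ - 0ℚ) ≡ (x + 1ℚ) * 1ℚ
  base = solve-∀ ℚ-ring
falling-+1 x (suc m) = begin
  falling (x + 1ℚ) (suc m) * (x + 1ℚ - ℕtoℚ (suc m))
    ≡⟨ cong₂ (λ f c → f * (x + 1ℚ - c)) (falling-+1 x m) (ℕtoℚ-+ 1 m) ⟩
  (x + 1ℚ) * falling x m * (x + 1ℚ - (1ℚ + ℕtoℚ m))
    ≡⟨ step x (falling x m) (ℕtoℚ m) ⟩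
  (x + 1ℚ) * (falling x m * (x - ℕtoℚ m))
    ∎
  where
  step : ∀ x f c → (x + 1ℚ) * f * (x + 1ℚ - (1ℚ + c)) ≡ (x + 1ℚ) * (f * (x - c))
  step = solve-∀ ℚ-ring

falling≡B : ∀ q s → falling (q + ℕtoℚ s) (suc s) ≡ B q s
falling≡B q zero    = base q
  where
  base : ∀ q → 1ℚ * (q + 0ℚ - 0ℚ) ≡ q
  base = solve-∀ ℚ-ring
falling≡B q (suc s) = begin
  falling (q + ℕtoℚ (suc s)) (suc (suc s))  ≡⟨ cong (λ x → falling x (suc (suc s))) (+ℕtoℚ-suc q s) ⟩
  falling (x + 1ℚ) (suc (suc s))            ≡⟨ falling-+1 x (suc s) ⟩
  (x + 1ℚ) * falling x (suc s)              ≡⟨ cong ((x + 1ℚ) *_) (falling≡B q s) ⟩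
  (x + 1ℚ) * B q s                          ≡⟨ *-comm (x + 1ℚ) (B q s) ⟩
  B q s * (x + 1ℚ)                          ≡⟨ cong (B q s *_) (sym (+ℕtoℚ-suc q s)) ⟩
  B q s * (q + ℕtoℚ (suc s))                ∎
  where x = q + ℕtoℚ s

binomQ-rising : ∀ q s → binomQ (q + ℕtoℚ s) (suc s) ≡ B q s * inv! (suc s)
binomQ-rising q s = cong (_* inv! (suc s)) (falling≡B q s)

binomQ-pascal : ∀ x m → binomQ x m + binomQ x (suc m) ≡ binomQ (x + 1ℚ) (suc m)
binomQ-pascal x m = begin
  f * inv! m + f * (x - ℕtoℚ m) * E
    ≡⟨ cong (λ e → f * e + f * (x - ℕtoℚ m) * E) (sym (inv!-suc m)) ⟩
  f * (ℕtoℚ (suc m) * E) + f * (x - ℕtoℚ m) * E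
    ≡⟨ cong (λ c → f * (c * E) + f * (x - ℕtoℚ m) * E) (ℕtoℚ-+ 1 m) ⟩
  f * ((1ℚ + ℕtoℚ m) * E) + f * (x - ℕtoℚ m) * E
    ≡⟨ collect f (ℕtoℚ m) E x ⟩
  (x + 1ℚ) * f * E
    ≡⟨ cong (_* E) (sym (falling-+1 x m)) ⟩
  falling (x + 1ℚ) (suc m) * E
    ∎
  where
  f = falling x m
  E = inv! (suc m)
  collect : ∀ f c E x → f * ((1ℚ + c) * E) + f * (x - c) * E ≡ (x + 1ℚ) * f * E
  collect = solve-∀ ℚ-ring

-- Chu–Vandermonde: Σⱼ C(q, p + j) C(s, j − 1) = C(q + s, p + s + 1).  The sum is over
-- j < N for any N > s + 1, beyond which the terms vanish.
chuVandermonde : ∀ q p s N → suc s < N →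
  ∑[ j ∈ upTo N ] (binomQ q (p ℕ.+ j) * compositions j (suc s)) ≡ binomQ (q + ℕtoℚ s) (p ℕ.+ suc s)
chuVandermonde q p zero    (suc zero)    (s≤s ())
chuVandermonde q p zero    (suc (suc N)) _ = begin
  ∑ (upTo (2 ℕ.+ N)) f
    ≡⟨ ∑-upTo-suc (suc N) f ⟩
  f 0 + ∑[ j ∈ upTo (suc N) ] f (suc j)
    ≡⟨ cong (f 0 +_) (∑-upTo-suc N (λ j → f (suc j))) ⟩
  f 0 + (f 1 + ∑[ j ∈ upTo N ] f (2 ℕ.+ j))
    ≡⟨ cong₂ (λ a b → a + (f 1 + b)) (*-zeroʳ (binomQ q (p ℕ.+ 0))) vanish ⟩
  0ℚ + (f 1 + 0ℚ)
    ≡⟨ trans (+-identityˡ (f 1 + 0ℚ)) (+-identityʳ (f 1)) ⟩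
  binomQ q (p ℕ.+ 1) * 1ℚ
    ≡⟨ *-identityʳ (binomQ q (p ℕ.+ 1)) ⟩
  binomQ q (p ℕ.+ 1)
    ≡⟨ cong (λ x → binomQ x (p ℕ.+ 1)) (sym (+-identityʳ q)) ⟩
  binomQ (q + 0ℚ) (p ℕ.+ 1)
    ∎
  where
  f : ℕ → ℚ
  f j = binomQ q (p ℕ.+ j) * compositions j 1
  vanish : ∑[ j ∈ upTo N ] f (2 ℕ.+ j) ≡ 0ℚ
  vanish = trans (∑-cong (upTo N) (λ j → *-zeroʳ (binomQ q (p ℕ.+ (2 ℕ.+ j))))) (∑-zero (upTo N))
chuVandermonde q p (suc s) (suc N)       (s≤s 2+s<N) = begin
  ∑ (upTo (suc N)) (f (suc s))
    ≡⟨ ∑-upTo-suc N (f (suc s)) ⟩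
  f (suc s) 0 + ∑[ j ∈ upTo N ] f (suc s) (suc j)
    ≡⟨ cong₂ _+_ (*-zeroʳ (binomQ q (p ℕ.+ 0))) (∑-cong (upTo N) pascalTerm) ⟩
  0ℚ + ∑[ j ∈ upTo N ] (f s (suc j) + g j)
    ≡⟨ trans (+-identityˡ _) (∑-+ (upTo N) (λ j → f s (suc j)) g) ⟩
  ∑[ j ∈ upTo N ] f s (suc j) + ∑ (upTo N) g
    ≡⟨ cong₂ _+_ dropFirst (chuVandermonde q (suc p) s N 2+s<N) ⟩
  binomQ x (p ℕ.+ suc s) + binomQ x (suc (p ℕ.+ suc s))
    ≡⟨ binomQ-pascal x (p ℕ.+ suc s) ⟩
  binomQ (x + 1ℚ) (suc (p ℕ.+ suc s))
    ≡⟨ cong₂ binomQ (sym (+ℕtoℚ-suc q s)) (sym (ℕ.+-suc p (suc s))) ⟩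
  binomQ (q + ℕtoℚ (suc s)) (p ℕ.+ suc (suc s))
    ∎
  where
  x = q + ℕtoℚ s
  f : ℕ → ℕ → ℚ
  f t j = binomQ q (p ℕ.+ j) * compositions j (suc t)
  g : ℕ → ℚ
  g j = binomQ q (suc p ℕ.+ j) * compositions j (suc s)
  pascalTerm : ∀ j → f (suc s) (suc j) ≡ f s (suc j) + g j
  pascalTerm j = trans (*-distribˡ-+ (binomQ q (p ℕ.+ suc j)) (compositions (suc j) (suc s)) (compositions j (suc s)))
                       (cong (λ m → f s (suc j) + binomQ q m * compositions j (suc s)) (ℕ.+-suc p j))
  dropFirst : ∑[ j ∈ upTo N ] f s (suc j) ≡ binomQ x (p ℕ.+ suc s)
  dropFirst = begin
    ∑[ j ∈ upTo N ] f s (suc j)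
      ≡⟨ sym (+-identityˡ _) ⟩
    0ℚ + ∑[ j ∈ upTo N ] f s (suc j)
      ≡⟨ cong (_+ ∑[ j ∈ upTo N ] f s (suc j)) (sym (*-zeroʳ (binomQ q (p ℕ.+ 0)))) ⟩
    f s 0 + ∑[ j ∈ upTo N ] f s (suc j)
      ≡⟨ sym (∑-upTo-suc N (f s)) ⟩
    ∑ (upTo (suc N)) (f s)
      ≡⟨ chuVandermonde q p s (suc N) (ℕ.m<n⇒m<1+n 2+s<N) ⟩
    binomQ x (p ℕ.+ suc s)
      ∎

rootCoeff : ℚ → ℕ → ℕ → ℚ
rootCoeff q n s = ∑[ m ∈ upTo (suc n) ] (binomQ q m * compositions m s)

convRoot-F : ∀ k q n (α : Vec ℕ k) →
  convRoot q (F k) n α ≡ monomial (weight α) (multinomial α * rootCoeff q n (size α)) n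
convRoot-F k q n α = begin
  ∑[ m ∈ upTo (suc n) ] (binomQ q m * powPos (F k) m n α)
    ≡⟨ ∑-cong (upTo (suc n)) (λ m → cong (binomQ q m *_) (powPos-F≡byWeight k m n α)) ⟩
  ∑[ m ∈ upTo (suc n) ] (binomQ q m * monomial (weight α) (powPosCoeff m (size α) * prodInv! α) n)
    ≡⟨ ∑-cong (upTo (suc n)) term ⟩
  ∑[ m ∈ upTo (suc n) ] monomial (weight α) (multinomial α * c m) n
    ≡⟨ ∑-monomial (upTo (suc n)) (weight α) n (λ m → multinomial α * c m) ⟩
  monomial (weight α) (∑[ m ∈ upTo (suc n) ] (multinomial α * c m)) n
    ≡⟨ cong (λ x → monomial (weight α) x n) (∑-*ˡ (upTo (suc n)) (multinomial α) c) ⟩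
  monomial (weight α) (multinomial α * rootCoeff q n (size α)) n
    ∎
  where
  c : ℕ → ℚ
  c m = binomQ q m * compositions m (size α)
  regroup : ∀ b f c p → b * (f * c * p) ≡ f * p * (b * c)
  regroup = solve-∀ ℚ-ring
  term : ∀ m → binomQ q m * monomial (weight α) (powPosCoeff m (size α) * prodInv! α) n ≡
               monomial (weight α) (multinomial α * c m) n
  term m = trans (*-monomial (weight α) (binomQ q m) (powPosCoeff m (size α) * prodInv! α) n)
                 (cong (λ x → monomial (weight α) x n)
                       (regroup (binomQ q m) (ℕtoℚ (size α !)) (compositions m (size α)) (prodInv! α)))

multinomial*rootCoeff : ∀ q n (α : Vec ℕ k) → weight α ≡ suc n →
  multinomial α * rootCoeff q (suc n) (size α) ≡ inv! (size α) * B q (size α ∸ 1) * multinomial α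
multinomial*rootCoeff q n α w with weight≡suc⇒size≡suc α w
... | s , size≡1+s = begin
  multinomial α * rootCoeff q (suc n) (size α)
    ≡⟨ cong (λ t → multinomial α * rootCoeff q (suc n) t) size≡1+s ⟩
  multinomial α * rootCoeff q (suc n) (suc s)
    ≡⟨ cong (multinomial α *_) (chuVandermonde q 0 s (2 ℕ.+ n) (s≤s 1+s≤1+n)) ⟩
  multinomial α * binomQ (q + ℕtoℚ s) (suc s)
    ≡⟨ cong (multinomial α *_) (binomQ-rising q s) ⟩
  multinomial α * (B q s * inv! (suc s))
    ≡⟨ reverse (multinomial α) (B q s) (inv! (suc s)) ⟩
  inv! (suc s) * B q s * multinomial α
    ≡⟨ cong (λ t → inv! t * B q (t ∸ 1) * multinomial α) (sym size≡1+s) ⟩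
  inv! (size α) * B q (size α ∸ 1) * multinomial α
    ∎
  where
  1+s≤1+n : suc s ≤ suc n
  1+s≤1+n = subst₂ _≤_ size≡1+s w (size≤weightFrom 0 α)
  reverse : ∀ x y z → x * (y * z) ≡ z * y * x
  reverse = solve-∀ ℚ-ring

theorem10 : (k : ℕ) → 1 ≤ k → (q : ℚ) →
    ((α : Vec ℕ k) → convRoot q (F k) 0 α ≡ onePoly α) ×
    ((n : ℕ) → 1 ≤ n → (α : Vec ℕ k) → convRoot q (F k) n α ≡ Hformula q n α)
theorem10 k _ q = convRoot-0 , convRoot-suc
  where
  convRoot-0 : (α : Vec ℕ k) → convRoot q (F k) 0 α ≡ onePoly α
  convRoot-0 α = trans (+-identityʳ _) (*-identityˡ (onePoly α))
  convRoot-suc : (n : ℕ) → 1 ≤ n → (α : Vec ℕ k) → convRoot q (F k) n α ≡ Hformula q n α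
  convRoot-suc (suc n) _ α =
    trans (convRoot-F k q (suc n) α) (monomial-cong (weight α) (suc n) (multinomial*rootCoeff q n α))
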